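{- Let $q$ be a prime power, $d\ge2$ and $m,n$ positive integers. Then \[ \mathrm{Q}_{\mathbb{F}_q}\left(T^{\mathbb{F}_q}_{d,\mathbb{F}_{q^{mn}}}\right)\ge\mathrm{Q}_{\mathbb{F}_q}\left(T^{\mathbb{F}_q}_{d,\mathbb{F}_{q^m}}\right)\cdot\mathrm{Q}_{\mathbb{F}_{q^m}}\left(T^{\mathbb{F}_{q^m}}_{d,\mathbb{F}_{q^{mn}}}\right). \]
   Context: For a finite extension $\mathbb{L}/\mathbb{K}$ of degree $l$ and $d\ge2$, $T^{\mathbb{K}}_{d,\mathbb{L}}\in(\mathbb{K}^l)^{\otimes d}$ is the structure tensor over $\mathbb{K}$ of the $\mathbb{K}$-multilinear map $\mathbb{L}^{d-1}\to\mathbb{L}$, $(x_1,\dots,x_{d-1})\mapsto x_1\cdots x_{d-1}$ (coefficients $t_{j_1\cdots j_d}$ with $\omega_{j_1}\cdots\omega_{j_{d-1}}=\sum_{j_d}t_{j_1\cdots j_d}\omega_{j_d}$ for a $\mathbb{K}$-basis $(\omega_j)$ of $\mathbb{L}$). Over a field $\mathbb{K}$, $S\preceq T$ means $S=(g_1\otimes\cdots\otimes g_d)T$ for $\mathbb{K}$-linear maps $g_i$; $\mathrm{Id}_s=\sum_{j=1}^se_j^{\otimes d}$; $\mathrm{Q}_{\mathbb{K}}(T)=\max\{s:\mathrm{Id}_s\preceq T\}$. -}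

module Defs where

open import Level using (0ℓ)
open import Data.Nat using (ℕ; zero; suc)
open import Data.Fin using (Fin; zero; suc; inject₁; fromℕ)
open import Data.Fin.Properties using (_≟_)
open import Data.Bool using (Bool; true; false; _∧_; if_then_else_)
open import Data.Product using (∃; _×_)
open import Data.Nat using (_≤_)
open import Relation.Nullary using (¬_)
open import Relation.Nullary.Decidable using (⌊_⌋)
open import Algebra.Bundles using (CommutativeRing)
open import Algebra.Morphism.Structures using (IsRingHomomorphism)
open import Function.Bundles using (Bijection)
import Relation.Binary.PropositionalEquality as ≡

record Field : Set₁ where
  field
    commutativeRing : CommutativeRing 0ℓ 0ℓ
  open CommutativeRing commutativeRing public
  field
    0≉1 : ¬ (0# ≈ 1#)
    inverse : ∀ x → ¬ (x ≈ 0#) → ∃ λ y → (x * y) ≈ 1#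

open Field using (Carrier; setoid; rawRing; _≈_; _+_; _*_; 0#; 1#)

-- Field homomorphism (= ring homomorphism; automatically injective).
IsFieldHom : (K L : Field) → (Carrier K → Carrier L) → Set
IsFieldHom K L f = IsRingHomomorphism (rawRing K) (rawRing L) f

HasCard : Field → ℕ → Set
HasCard K q = Bijection (setoid K) (≡.setoid (Fin q))

sumF : (K : Field) → (n : ℕ) → (Fin n → Carrier K) → Carrier K
sumF K zero f = 0# K
sumF K (suc n) f = _+_ K (f zero) (sumF K n (λ j → f (suc j)))

prodF : (K : Field) → (n : ℕ) → (Fin n → Carrier K) → Carrier K
prodF K zero f = 1# K
prodF K (suc n) f = _*_ K (f zero) (prodF K n (λ j → f (suc j)))

sumAll : (K : Field) → (d l : ℕ) → ((Fin d → Fin l) → Carrier K) → Carrier K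
sumAll K zero l f = f (λ ())
sumAll K (suc d) l f = sumF K l (λ j → sumAll K d l (λ js → f (cons j js)))
  where
  cons : Fin l → (Fin d → Fin l) → Fin (suc d) → Fin l
  cons j js zero = j
  cons j js (suc k) = js k

record Basis (K L : Field) (i : Carrier K → Carrier L) (l : ℕ) : Set where
  field
    ω : Fin l → Carrier L
    coord : Carrier L → Fin l → Carrier K
    expand : ∀ x → _≈_ L x (sumF L l (λ j → _*_ L (i (coord x j)) (ω j)))
    unique : ∀ (c : Fin l → Carrier K) x →
             _≈_ L x (sumF L l (λ j → _*_ L (i (c j)) (ω j))) →
             ∀ j → _≈_ K (c j) (coord x j)

-- tensors in (K^l)^{⊗d}, as coefficient arrays
Tensor : Field → ℕ → ℕ → Set
Tensor K d l = (Fin d → Fin l) → Carrier K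

-- structure tensor T^K_{d,L} w.r.t. basis B:
-- ω_{j_1}⋯ω_{j_{d-1}} = Σ_{j_d} t_{j_1…j_d} ω_{j_d}  (junk value 0 for d = 0)
structureTensor : (K L : Field) (i : Carrier K → Carrier L) (l : ℕ) →
                  Basis K L i l → (d : ℕ) → Tensor K d l
structureTensor K L i l B zero js = 0# K
structureTensor K L i l B (suc e) js =
  Basis.coord B (prodF L e (λ k → Basis.ω B (js (inject₁ k)))) (js (fromℕ e))

allEq : {d s : ℕ} → (Fin d → Fin s) → Bool
allEq {zero} a = true
allEq {suc zero} a = true
allEq {suc (suc d)} a = ⌊ a zero ≟ a (suc zero) ⌋ ∧ allEq {suc d} (λ k → a (suc k))

unitTensor : (K : Field) (d s : ℕ) → Tensor K d s
unitTensor K d s a = if allEq a then 1# K else 0# K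

-- restriction S ⪯ T : S = (g_1 ⊗ ⋯ ⊗ g_d) T with g_k : K^l → K^s linear (matrices A k)
Restriction : (K : Field) (d s l : ℕ) → Tensor K d s → Tensor K d l → Set
Restriction K d s l S T =
  ∃ λ (A : Fin d → Fin s → Fin l → Carrier K) →
    ∀ (a : Fin d → Fin s) →
      _≈_ K (S a) (sumAll K d l (λ js → _*_ K (prodF K d (λ k → A k (a k) (js k))) (T js)))

IsSubrank : (K : Field) (d l : ℕ) → Tensor K d l → ℕ → Set
IsSubrank K d l T Q =
  Restriction K d Q l (unitTensor K d Q) T ×
  (∀ s → Restriction K d s l (unitTensor K d s) T → s ≤ Q)

{-# OPTIONS --safe #-}
-- Id_s ⪯ T^K_{d,L} says exactly that there are vectors u_k(b) ∈ L (k < d - 1, b < s) and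
-- K-linear forms ψ_b : L → K with ψ_{a_d}(u_1(a_1) ⋯ u_{d-1}(a_{d-1})) = δ(a), a description that
-- no longer mentions a basis.  For a tower K ⊆ M ⊆ L such data for M/K (size s₁) and for L/M
-- (size s₂) multiply: the vectors j(u¹_k(b₁))·u²_k(b₂) and the forms ψ¹_{b₁} ∘ ψ²_{b₂} realise
-- Id_{s₁s₂} for L/K, because ψ² is M-linear and δ(a) = δ(a¹)δ(a²) for indices a = (a¹, a²).
module Submission where

open import Defs
open import Data.Nat using (ℕ; zero; suc; _≤_; _*_; _^_)
open import Function using (_∘_)
open import Data.Fin using (Fin; zero; suc; inject₁; fromℕ; punchIn; remQuot; combine)
open import Data.Fin.Properties using (_≟_; combine-remQuot)
open import Data.Vec.Functional using (Vector; init; last; insertAt)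
open import Data.Vec.Functional.Properties using (insertAt-lookup; insertAt-punchIn)
open import Data.Bool using (true; false; _∧_; if_then_else_)
open import Data.Bool.Properties using (∧-commutativeMonoid)
open import Data.Empty using (⊥-elim)
open import Data.Product using (_,_; proj₁; proj₂)
open import Relation.Nullary using (yes; no)
open import Relation.Nullary.Decidable using (⌊_⌋)
open import Relation.Binary.PropositionalEquality as ≡ using (_≡_)
open import Algebra.Bundles using (CommutativeMonoid)
open import Algebra.Morphism.Structures using (IsRingHomomorphism)
import Algebra.Morphism.Construct.Composition as Composition
import Algebra.Properties.CommutativeSemigroup as CommutativeSemigroupProperties
import Algebra.Solver.CommutativeMonoid as CommutativeMonoidSolver
import Relation.Binary.Reasoning.Setoid as SetoidReasoning

module FieldSums (F : Field) where
  open Field F hiding (zero) renaming (_*_ to _·_)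
  open CommutativeSemigroupProperties +-commutativeSemigroup using () renaming (interchange to +-interchange)
  open CommutativeSemigroupProperties *-commutativeSemigroup using () renaming (interchange to *-interchange)

  sumF-cong : ∀ n {f g : Fin n → Carrier} → (∀ k → f k ≈ g k) → sumF F n f ≈ sumF F n g
  sumF-cong zero    f≈g = refl
  sumF-cong (suc n) f≈g = +-cong (f≈g zero) (sumF-cong n (f≈g ∘ suc))

  sumF-+ : ∀ n (f g : Fin n → Carrier) → sumF F n (λ k → f k + g k) ≈ sumF F n f + sumF F n g
  sumF-+ zero    f g = sym (+-identityˡ 0#)
  sumF-+ (suc n) f g = trans (+-congˡ (sumF-+ n (f ∘ suc) (g ∘ suc))) (+-interchange _ _ _ _)

  *-distribˡ-sumF : ∀ n x (f : Fin n → Carrier) → x · sumF F n f ≈ sumF F n (λ k → x · f k)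
  *-distribˡ-sumF zero    x f = zeroʳ x
  *-distribˡ-sumF (suc n) x f = trans (distribˡ x _ _) (+-congˡ (*-distribˡ-sumF n x (f ∘ suc)))

  *-distribʳ-sumF : ∀ n x (f : Fin n → Carrier) → sumF F n f · x ≈ sumF F n (λ k → f k · x)
  *-distribʳ-sumF zero    x f = zeroˡ x
  *-distribʳ-sumF (suc n) x f = trans (distribʳ x _ _) (+-congˡ (*-distribʳ-sumF n x (f ∘ suc)))

  prodF-cong : ∀ n {f g : Fin n → Carrier} → (∀ k → f k ≈ g k) → prodF F n f ≈ prodF F n g
  prodF-cong zero    f≈g = refl
  prodF-cong (suc n) f≈g = *-cong (f≈g zero) (prodF-cong n (f≈g ∘ suc))

  prodF-* : ∀ n (f g : Fin n → Carrier) → prodF F n (λ k → f k · g k) ≈ prodF F n f · prodF F n g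
  prodF-* zero    f g = sym (*-identityˡ 1#)
  prodF-* (suc n) f g = trans (*-congˡ (prodF-* n (f ∘ suc) (g ∘ suc))) (*-interchange _ _ _ _)

  sumAll-cong : ∀ d l {f g : (Fin d → Fin l) → Carrier} → (∀ js → f js ≈ g js) →
                sumAll F d l f ≈ sumAll F d l g
  sumAll-cong zero    l f≈g = f≈g _
  sumAll-cong (suc d) l f≈g = sumF-cong l (λ j → sumAll-cong d l (λ js → f≈g _))

  *-distribˡ-sumAll : ∀ d l x (f : (Fin d → Fin l) → Carrier) →
                      x · sumAll F d l f ≈ sumAll F d l (λ js → x · f js)
  *-distribˡ-sumAll zero    l x f = refl
  *-distribˡ-sumAll (suc d) l x f = trans (*-distribˡ-sumF l x _) (sumF-cong l (λ j → *-distribˡ-sumAll d l x _))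

record IsLinearForm (K L : Field) (i : Field.Carrier K → Field.Carrier L)
                    (ψ : Field.Carrier L → Field.Carrier K) : Set where
  field
    cong    : ∀ {x y} → Field._≈_ L x y → Field._≈_ K (ψ x) (ψ y)
    +-homo  : ∀ x y → Field._≈_ K (ψ (Field._+_ L x y)) (Field._+_ K (ψ x) (ψ y))
    *ₗ-homo : ∀ c x → Field._≈_ K (ψ (Field._*_ L (i c) x)) (Field._*_ K c (ψ x))

∘-isLinearForm : ∀ {K M L : Field} {i : Field.Carrier K → Field.Carrier M} {j : Field.Carrier M → Field.Carrier L}
                   {φ : Field.Carrier M → Field.Carrier K} {χ : Field.Carrier L → Field.Carrier M} →
                 IsLinearForm K M i φ → IsLinearForm M L j χ → IsLinearForm K L (j ∘ i) (φ ∘ χ)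
∘-isLinearForm {K} φ-linear χ-linear = record
  { cong    = φ.cong ∘ χ.cong
  ; +-homo  = λ x y → Field.trans K (φ.cong (χ.+-homo x y)) (φ.+-homo _ _)
  ; *ₗ-homo = λ c x → Field.trans K (φ.cong (χ.*ₗ-homo _ x)) (φ.*ₗ-homo c _)
  }
  where
  module φ = IsLinearForm φ-linear
  module χ = IsLinearForm χ-linear

-- The basis-free form of Id_s ⪯ T^K_{e+1,L} from the header.
record IdRealisation (K L : Field) (i : Field.Carrier K → Field.Carrier L) (e s : ℕ) : Set where
  field
    vectors      : Fin e → Fin s → Field.Carrier L
    forms        : Fin s → Field.Carrier L → Field.Carrier K
    forms-linear : ∀ b → IsLinearForm K L i (forms b)
    realises     : ∀ (a : Fin (suc e) → Fin s) →
                   Field._≈_ K (unitTensor K (suc e) s a) (forms (last a) (prodF L e (λ k → vectors k (init a k))))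

Id⪯Structure : (K L : Field) (i : Field.Carrier K → Field.Carrier L) {l : ℕ} → Basis K L i l → (d s : ℕ) → Set
Id⪯Structure K L i {l} B d s = Restriction K d s l (unitTensor K d s) (structureTensor K L i l B d)

module Extension (K L : Field) (i : Field.Carrier K → Field.Carrier L) (i-hom : IsFieldHom K L i) where
  private
    module K = Field K
    module L = Field L
    module i = IsRingHomomorphism i-hom

  hom-prodF : ∀ n (f : Fin n → K.Carrier) → i (prodF K n f) L.≈ prodF L n (i ∘ f)
  hom-prodF zero    f = i.1#-homo
  hom-prodF (suc n) f = L.trans (i.*-homo _ _) (L.*-congˡ (hom-prodF n (f ∘ suc)))

  hom-unitTensor : ∀ d s (a : Fin d → Fin s) → i (unitTensor K d s a) L.≈ unitTensor L d s a
  hom-unitTensor d s a with allEq a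
  ... | true  = i.1#-homo
  ... | false = i.0#-homo

  module _ {ψ : L.Carrier → K.Carrier} (ψ-linear : IsLinearForm K L i ψ) where
    open IsLinearForm ψ-linear

    linearForm-0 : ψ L.0# K.≈ K.0#
    linearForm-0 = K.trans (cong (L.sym (L.trans (L.*-congʳ i.0#-homo) (L.zeroˡ L.0#))))
                           (K.trans (*ₗ-homo K.0# L.0#) (K.zeroˡ _))

    linearForm-sumF : ∀ n (c : Fin n → K.Carrier) (y : Fin n → L.Carrier) →
                      ψ (sumF L n (λ k → i (c k) L.* y k)) K.≈ sumF K n (λ k → c k K.* ψ (y k))
    linearForm-sumF zero    c y = linearForm-0
    linearForm-sumF (suc n) c y =
      K.trans (+-homo _ _) (K.+-cong (*ₗ-homo _ _) (linearForm-sumF n (c ∘ suc) (y ∘ suc)))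

insertAt-last-init : ∀ {a} {A : Set a} {n} (xs : Vector A n) (x : A) (k : Fin n) →
                     insertAt xs (fromℕ n) x (inject₁ k) ≡ xs k
insertAt-last-init xs x k = ≡.trans (≡.cong (insertAt xs (fromℕ _) x) (≡.sym (punchIn-fromℕ k)))
                                    (insertAt-punchIn xs (fromℕ _) x k)
  where
  punchIn-fromℕ : ∀ {n} (k : Fin n) → punchIn (fromℕ n) k ≡ inject₁ k
  punchIn-fromℕ zero    = ≡.refl
  punchIn-fromℕ (suc k) = ≡.cong suc (punchIn-fromℕ k)

module ExtensionBasis (K L : Field) (i : Field.Carrier K → Field.Carrier L) (i-hom : IsFieldHom K L i)
                      {l : ℕ} (B : Basis K L i l) where
  private
    module K = Field K
    module L = Field L
    module ΣK = FieldSums K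
    module ΣL = FieldSums L
    module i = IsRingHomomorphism i-hom
  open Extension K L i i-hom
  open Basis B

  coord-cong : ∀ {x y} → x L.≈ y → ∀ j → coord x j K.≈ coord y j
  coord-cong {x} {y} x≈y = unique (coord x) y (L.trans (L.sym x≈y) (expand x))

  coord-+ : ∀ x y j → coord (x L.+ y) j K.≈ coord x j K.+ coord y j
  coord-+ x y j = K.sym (unique (λ j → coord x j K.+ coord y j) (x L.+ y) expansion j)
    where
    expansion = L.trans (L.+-cong (expand x) (expand y))
                (L.trans (L.sym (ΣL.sumF-+ l _ _))
                 (ΣL.sumF-cong l (λ k → L.sym (L.trans (L.*-congʳ (i.+-homo _ _)) (L.distribʳ _ _ _)))))

  coord-*ₗ : ∀ c x j → coord (i c L.* x) j K.≈ c K.* coord x j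
  coord-*ₗ c x j = K.sym (unique (λ j → c K.* coord x j) (i c L.* x) expansion j)
    where
    expansion = L.trans (L.*-congˡ (expand x))
                (L.trans (ΣL.*-distribˡ-sumF l _ _)
                 (ΣL.sumF-cong l (λ k → L.trans (L.sym (L.*-assoc _ _ _)) (L.*-congʳ (L.sym (i.*-homo _ _))))))

  combination : (Fin l → K.Carrier) → L.Carrier
  combination c = sumF L l (λ j → i (c j) L.* ω j)

  dualCombination : (Fin l → K.Carrier) → L.Carrier → K.Carrier
  dualCombination c y = sumF K l (λ j → c j K.* coord y j)

  dualCombination-isLinearForm : ∀ c → IsLinearForm K L i (dualCombination c)
  dualCombination-isLinearForm c = record
    { cong    = λ x≈y → ΣK.sumF-cong l (λ j → K.*-congˡ (coord-cong x≈y j))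
    ; +-homo  = λ x y → K.trans (ΣK.sumF-cong l (λ j → K.trans (K.*-congˡ (coord-+ x y j)) (K.distribˡ _ _ _)))
                                (ΣK.sumF-+ l _ _)
    ; *ₗ-homo = λ a x → K.trans (ΣK.sumF-cong l (λ j → K.trans (K.*-congˡ (coord-*ₗ a x j)) (x∙yz≈y∙xz _ _ _)))
                                (K.sym (ΣK.*-distribˡ-sumF l a _))
    }
    where open CommutativeSemigroupProperties K.*-commutativeSemigroup using (x∙yz≈y∙xz)

  linearForm-dualCombination : ∀ {ψ} → IsLinearForm K L i ψ → ∀ y → ψ y K.≈ dualCombination (ψ ∘ ω) y
  linearForm-dualCombination {ψ} ψ-linear y =
    K.trans (IsLinearForm.cong ψ-linear (expand y))
    (K.trans (linearForm-sumF ψ-linear l (coord y) ω) (ΣK.sumF-cong l (λ j → K.*-comm _ _)))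

  -- The factor x makes the induction go through: peeling off the first index j turns x into x·ω_j.
  contract-scaledStructureTensor :
    ∀ e (c : Fin (suc e) → Fin l → K.Carrier) (x : L.Carrier) →
    sumAll K (suc e) l (λ js → prodF K (suc e) (λ k → c k (js k)) K.*
                               coord (x L.* prodF L e (λ k → ω (js (inject₁ k)))) (js (fromℕ e)))
      K.≈ dualCombination (last c) (x L.* prodF L e (combination ∘ init c))
  contract-scaledStructureTensor zero    c x = ΣK.sumF-cong l (λ j → K.*-congʳ (K.*-identityʳ _))
  contract-scaledStructureTensor (suc e) c x = begin
    sumF K l (λ j → sumAll K (suc e) l (λ js → (c zero j K.* P js) K.* coord (x L.* (ω j L.* Pω js)) (js (fromℕ e))))
      ≈⟨ ΣK.sumF-cong l (λ j → K.trans (ΣK.sumAll-cong (suc e) l (regroup j))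
                                       (K.sym (ΣK.*-distribˡ-sumAll (suc e) l (c zero j) (scaledBy j)))) ⟩
    sumF K l (λ j → c zero j K.* sumAll K (suc e) l (scaledBy j))
      ≈⟨ ΣK.sumF-cong l (λ j → K.*-congˡ (contract-scaledStructureTensor e (c ∘ suc) (x L.* ω j))) ⟩
    sumF K l (λ j → c zero j K.* ψ ((x L.* ω j) L.* V))
      ≈⟨ linearForm-sumF (dualCombination-isLinearForm (last c)) l (c zero) _ ⟨
    ψ (sumF L l (λ j → i (c zero j) L.* ((x L.* ω j) L.* V)))
      ≈⟨ IsLinearForm.cong (dualCombination-isLinearForm (last c)) pull-out ⟩
    ψ (x L.* (combination (c zero) L.* V)) ∎
    where
    open SetoidReasoning K.setoid
    open CommutativeMonoidSolver L.*-commutativeMonoid using (solve; _⊕_; _⊜_)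
    ψ = dualCombination (last c)
    P : (Fin (suc e) → Fin l) → K.Carrier
    P js = prodF K (suc e) (λ k → c (suc k) (js k))
    Pω : (Fin (suc e) → Fin l) → L.Carrier
    Pω js = prodF L e (λ k → ω (js (inject₁ k)))
    V = prodF L e (combination ∘ init (c ∘ suc))
    scaledBy : Fin l → (Fin (suc e) → Fin l) → K.Carrier
    scaledBy j js = P js K.* coord ((x L.* ω j) L.* Pω js) (js (fromℕ e))
    regroup : ∀ j js → (c zero j K.* P js) K.* coord (x L.* (ω j L.* Pω js)) (js (fromℕ e))
                       K.≈ c zero j K.* scaledBy j js
    regroup j js = K.trans (K.*-assoc _ _ _) (K.*-congˡ (K.*-congˡ (coord-cong (L.sym (L.*-assoc _ _ _)) _)))
    pull-out : sumF L l (λ j → i (c zero j) L.* ((x L.* ω j) L.* V)) L.≈ x L.* (combination (c zero) L.* V)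
    pull-out = L.sym (L.trans (L.*-congˡ (ΣL.*-distribʳ-sumF l V _))
               (L.trans (ΣL.*-distribˡ-sumF l x _)
                (ΣL.sumF-cong l (λ j → solve 4 (λ x a w v → x ⊕ ((a ⊕ w) ⊕ v) ⊜ a ⊕ ((x ⊕ w) ⊕ v))
                                               L.refl x (i (c zero j)) (ω j) V))))

  contract-structureTensor : ∀ e (c : Fin (suc e) → Fin l → K.Carrier) →
    sumAll K (suc e) l (λ js → prodF K (suc e) (λ k → c k (js k)) K.* structureTensor K L i l B (suc e) js)
      K.≈ dualCombination (last c) (prodF L e (combination ∘ init c))
  contract-structureTensor e c = begin
    sumAll K (suc e) l entry
      ≈⟨ ΣK.sumAll-cong (suc e) l {entry} {scaledEntry}
                        (λ js → K.*-congˡ (coord-cong (L.sym (L.*-identityˡ _)) _)) ⟩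
    sumAll K (suc e) l scaledEntry
      ≈⟨ contract-scaledStructureTensor e c L.1# ⟩
    dualCombination (last c) (L.1# L.* prodF L e (combination ∘ init c))
      ≈⟨ IsLinearForm.cong (dualCombination-isLinearForm (last c)) (L.*-identityˡ _) ⟩
    dualCombination (last c) (prodF L e (combination ∘ init c)) ∎
    where
    open SetoidReasoning K.setoid
    entry scaledEntry : (Fin (suc e) → Fin l) → K.Carrier
    entry js = prodF K (suc e) (λ k → c k (js k)) K.* structureTensor K L i l B (suc e) js
    scaledEntry js = prodF K (suc e) (λ k → c k (js k)) K.*
                     coord (L.1# L.* prodF L e (λ k → ω (js (inject₁ k)))) (js (fromℕ e))

  restriction⇒realisation : ∀ {e s} → Id⪯Structure K L i B (suc e) s → IdRealisation K L i e s
  restriction⇒realisation (A , Id≈AT) = record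
    { vectors      = λ k b → combination (A (inject₁ k) b)
    ; forms        = λ b → dualCombination (last A b)
    ; forms-linear = λ b → dualCombination-isLinearForm (last A b)
    ; realises     = λ a → K.trans (Id≈AT a) (contract-structureTensor _ (λ k → A k (a k)))
    }

  realisation⇒restriction : ∀ {e s} → IdRealisation K L i e s → Id⪯Structure K L i B (suc e) s
  realisation⇒restriction {e} {s} R = A , Id≈AT
    where
    open IdRealisation R
    vectorCoords : Fin e → Fin s → Fin l → K.Carrier
    vectorCoords k b = coord (vectors k b)
    formValues : Fin s → Fin l → K.Carrier
    formValues b = forms b ∘ ω
    A : Fin (suc e) → Fin s → Fin l → K.Carrier
    A = insertAt vectorCoords (fromℕ e) formValues
    Id≈AT : ∀ a → unitTensor K (suc e) s a K.≈
                  sumAll K (suc e) l (λ js → prodF K (suc e) (λ k → A k (a k) (js k)) K.*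
                                             structureTensor K L i l B (suc e) js)
    Id≈AT a = begin
      unitTensor K (suc e) s a
        ≈⟨ realises a ⟩
      forms (last a) (prodF L e (λ k → vectors k (init a k)))
        ≈⟨ linearForm-dualCombination (forms-linear (last a)) _ ⟩
      dualCombination (forms (last a) ∘ ω) (prodF L e (λ k → vectors k (init a k)))
        ≈⟨ IsLinearForm.cong (dualCombination-isLinearForm _) (ΣL.prodF-cong e expand-vectors) ⟩
      dualCombination (forms (last a) ∘ ω) (prodF L e (combination ∘ init c))
        ≡⟨ ≡.cong (λ f → dualCombination f (prodF L e (combination ∘ init c)))
                  (≡.cong-app (insertAt-lookup vectorCoords (fromℕ e) formValues) (last a)) ⟨
      dualCombination (last c) (prodF L e (combination ∘ init c))
        ≈⟨ contract-structureTensor e c ⟨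
      sumAll K (suc e) l (λ js → prodF K (suc e) (λ k → A k (a k) (js k)) K.* structureTensor K L i l B (suc e) js) ∎
      where
      open SetoidReasoning K.setoid
      c : Fin (suc e) → Fin l → K.Carrier
      c k = A k (a k)
      expand-vectors : ∀ k → vectors k (init a k) L.≈ combination (init c k)
      expand-vectors k = L.trans (expand _)
        (L.reflexive (≡.cong combination (≡.sym (≡.cong-app (insertAt-last-init vectorCoords formValues k) (init a k)))))

module ProductIndex (s₁ s₂ : ℕ) where
  index₁ : Fin (s₁ * s₂) → Fin s₁
  index₁ = proj₁ ∘ remQuot {s₁} s₂

  index₂ : Fin (s₁ * s₂) → Fin s₂
  index₂ = proj₂ ∘ remQuot {s₁} s₂

  index-injective : ∀ x y → index₁ x ≡ index₁ y → index₂ x ≡ index₂ y → x ≡ y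
  index-injective x y x₁≡y₁ x₂≡y₂ =
    ≡.trans (≡.sym (combine-remQuot {s₁} s₂ x))
            (≡.trans (≡.cong₂ combine x₁≡y₁ x₂≡y₂) (combine-remQuot {s₁} s₂ y))

  ⌊≟⌋-index : ∀ x y → ⌊ x ≟ y ⌋ ≡ ⌊ index₁ x ≟ index₁ y ⌋ ∧ ⌊ index₂ x ≟ index₂ y ⌋
  ⌊≟⌋-index x y with x ≟ y | index₁ x ≟ index₁ y | index₂ x ≟ index₂ y
  ... | yes _   | yes _     | yes _     = ≡.refl
  ... | yes x≡y | no x₁≢y₁  | _         = ⊥-elim (x₁≢y₁ (≡.cong index₁ x≡y))
  ... | yes x≡y | yes _     | no x₂≢y₂  = ⊥-elim (x₂≢y₂ (≡.cong index₂ x≡y))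
  ... | no x≢y  | yes x₁≡y₁ | yes x₂≡y₂ = ⊥-elim (x≢y (index-injective x y x₁≡y₁ x₂≡y₂))
  ... | no _    | no _      | _         = ≡.refl
  ... | no _    | yes _     | no _      = ≡.refl

  allEq-index : ∀ d (a : Fin d → Fin (s₁ * s₂)) → allEq a ≡ allEq (index₁ ∘ a) ∧ allEq (index₂ ∘ a)
  allEq-index zero          a = ≡.refl
  allEq-index (suc zero)    a = ≡.refl
  allEq-index (suc (suc d)) a =
    ≡.trans (≡.cong₂ _∧_ (⌊≟⌋-index (a zero) (a (suc zero))) (allEq-index (suc d) (a ∘ suc)))
            (∧-interchange ⌊ index₁ (a zero) ≟ index₁ (a (suc zero)) ⌋ ⌊ index₂ (a zero) ≟ index₂ (a (suc zero)) ⌋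
                           (allEq (index₁ ∘ a ∘ suc)) (allEq (index₂ ∘ a ∘ suc)))
    where open CommutativeSemigroupProperties (CommutativeMonoid.commutativeSemigroup ∧-commutativeMonoid)
                 using () renaming (interchange to ∧-interchange)

  unitTensor-index : ∀ (F : Field) d (a : Fin d → Fin (s₁ * s₂)) →
    Field._≈_ F (unitTensor F d (s₁ * s₂) a)
                (Field._*_ F (unitTensor F d s₁ (index₁ ∘ a)) (unitTensor F d s₂ (index₂ ∘ a)))
  unitTensor-index F d a = trans (reflexive (≡.cong (λ b → if b then 1# else 0#) (allEq-index d a)))
                                 (if-∧ (allEq (index₁ ∘ a)) (allEq (index₂ ∘ a)))
    where
    open Field F renaming (_*_ to _·_)
    if-∧ : ∀ b₁ b₂ → (if b₁ ∧ b₂ then 1# else 0#) ≈ (if b₁ then 1# else 0#) · (if b₂ then 1# else 0#)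
    if-∧ true  b₂ = sym (*-identityˡ _)
    if-∧ false b₂ = sym (zeroˡ _)

module Tower (K M L : Field) (i : Field.Carrier K → Field.Carrier M) (i-hom : IsFieldHom K M i)
             (j : Field.Carrier M → Field.Carrier L) (j-hom : IsFieldHom M L j) where
  private
    module K = Field K
    module M = Field M
    module L = Field L
    module ΣL = FieldSums L
  open Extension K M i i-hom using (hom-unitTensor)
  open Extension M L j j-hom using (hom-prodF)

  realisation-* : ∀ {e s₁ s₂} → IdRealisation K M i e s₁ → IdRealisation M L j e s₂ →
                  IdRealisation K L (j ∘ i) e (s₁ * s₂)
  realisation-* {e} {s₁} {s₂} R₁ R₂ = record
    { vectors      = λ k p → j (R₁.vectors k (index₁ p)) L.* R₂.vectors k (index₂ p)
    ; forms        = λ p → R₁.forms (index₁ p) ∘ R₂.forms (index₂ p)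
    ; forms-linear = λ p → ∘-isLinearForm (R₁.forms-linear (index₁ p)) (R₂.forms-linear (index₂ p))
    ; realises     = realises
    }
    where
    module R₁ = IdRealisation R₁
    module R₂ = IdRealisation R₂
    open ProductIndex s₁ s₂
    realises : ∀ a → unitTensor K (suc e) (s₁ * s₂) a K.≈
                     R₁.forms (index₁ (last a)) (R₂.forms (index₂ (last a))
                       (prodF L e (λ k → j (R₁.vectors k (index₁ (init a k))) L.* R₂.vectors k (index₂ (init a k)))))
    realises a = begin
      unitTensor K (suc e) (s₁ * s₂) a     ≈⟨ unitTensor-index K (suc e) a ⟩
      unitTensor K (suc e) s₁ a₁ K.* δ₂    ≈⟨ K.*-congʳ (R₁.realises a₁) ⟩
      φ X K.* δ₂                           ≈⟨ K.*-comm _ _ ⟩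
      δ₂ K.* φ X                           ≈⟨ φ.*ₗ-homo δ₂ X ⟨
      φ (i δ₂ M.* X)                       ≈⟨ φ.cong (M.*-congʳ (hom-unitTensor (suc e) s₂ a₂)) ⟩
      φ (unitTensor M (suc e) s₂ a₂ M.* X) ≈⟨ φ.cong (M.*-congʳ (R₂.realises a₂)) ⟩
      φ (χ Y M.* X)                        ≈⟨ φ.cong (M.*-comm _ _) ⟩
      φ (X M.* χ Y)                        ≈⟨ φ.cong (χ.*ₗ-homo X Y) ⟨
      φ (χ (j X L.* Y))                    ≈⟨ φ.cong (χ.cong (L.*-congʳ (hom-prodF e _))) ⟩
      φ (χ (prodF L e (j ∘ u₁) L.* Y))     ≈⟨ φ.cong (χ.cong (ΣL.prodF-* e (j ∘ u₁) u₂)) ⟨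
      φ (χ (prodF L e (λ k → j (u₁ k) L.* u₂ k))) ∎
      where
      open SetoidReasoning K.setoid
      a₁ = index₁ ∘ a
      a₂ = index₂ ∘ a
      δ₂ = unitTensor K (suc e) s₂ a₂
      φ = R₁.forms (last a₁)
      χ = R₂.forms (last a₂)
      module φ = IsLinearForm (R₁.forms-linear (last a₁))
      module χ = IsLinearForm (R₂.forms-linear (last a₂))
      u₁ : Fin e → M.Carrier
      u₁ k = R₁.vectors k (init a₁ k)
      u₂ : Fin e → L.Carrier
      u₂ k = R₂.vectors k (init a₂ k)
      X = prodF M e u₁
      Y = prodF L e u₂

Id⪯Structure-tower :
  ∀ {K M L : Field} {i : Field.Carrier K → Field.Carrier M} {j : Field.Carrier M → Field.Carrier L} →
  (i-hom : IsFieldHom K M i) (j-hom : IsFieldHom M L j) →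
  ∀ {m n e s₁ s₂} (BKM : Basis K M i m) (BML : Basis M L j n) (BKL : Basis K L (j ∘ i) (m * n)) →
  Id⪯Structure K M i BKM (suc e) s₁ → Id⪯Structure M L j BML (suc e) s₂ →
  Id⪯Structure K L (j ∘ i) BKL (suc e) (s₁ * s₂)
Id⪯Structure-tower {K} {M} {L} {i} {j} i-hom j-hom BKM BML BKL Id⪯T₁ Id⪯T₂ =
  ExtensionBasis.realisation⇒restriction K L (j ∘ i) ji-hom BKL
    (Tower.realisation-* K M L i i-hom j j-hom
      (ExtensionBasis.restriction⇒realisation K M i i-hom BKM Id⪯T₁)
      (ExtensionBasis.restriction⇒realisation M L j j-hom BML Id⪯T₂))
  where
  ji-hom : IsFieldHom K L (j ∘ i)
  ji-hom = Composition.isRingHomomorphism (Field.trans L) i-hom j-hom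

lemma3p6 : (q d m n : ℕ) → 2 ≤ d → 1 ≤ m → 1 ≤ n →
    (K M L : Field) →
    HasCard K q → HasCard M (q ^ m) → HasCard L (q ^ (m * n)) →
    (i : Field.Carrier K → Field.Carrier M) → IsFieldHom K M i →
    (j : Field.Carrier M → Field.Carrier L) → IsFieldHom M L j →
    (BKM : Basis K M i m) → (BML : Basis M L j n) → (BKL : Basis K L (j ∘ i) (m * n)) →
    (Q₁ Q₂ Q₃ : ℕ) →
    IsSubrank K d m (structureTensor K M i m BKM d) Q₁ →
    IsSubrank M d n (structureTensor M L j n BML d) Q₂ →
    IsSubrank K d (m * n) (structureTensor K L (j ∘ i) (m * n) BKL d) Q₃ →
    Q₁ * Q₂ ≤ Q₃
lemma3p6 q (suc e) m n _ _ _ K M L _ _ _ i i-hom j j-hom BKM BML BKL Q₁ Q₂ Q₃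
         (Id⪯T₁ , _) (Id⪯T₂ , _) (_ , Q₃-maximal) =
  Q₃-maximal (Q₁ * Q₂) (Id⪯Structure-tower i-hom j-hom BKM BML BKL Id⪯T₁ Id⪯T₂)
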